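{- Let $k\ge 2$ be an even integer, let $GC_k(x,q)=\sum_{n\ge 0}\sum_{\pi\in[k]^n}x^nq^{\mathrm{gkcon}(\pi)}$, and put $b=x(q-1)$. Then $$GC_k(x,q)=\frac{\displaystyle\sum_{i=0}^{k}(-1)^{\lfloor\frac{i+1}{2}\rfloor}\binom{\lfloor\frac{k-i}{2}\rfloor+i}{i}b^i}{\displaystyle\sum_{i=0}^{k}(-1)^{\lfloor\frac{i+1}{2}\rfloor}\binom{\lfloor\frac{k-i}{2}\rfloor+i}{i}b^i-x\sum_{j=0}^{k-1}\left(1+(-1)^{\lfloor\frac{j}{2}\rfloor}\sum_{i=1}^{j}(-1)^{\lfloor\frac{j-i}{2}\rfloor}\binom{\lfloor\frac{j-i}{2}\rfloor+i}{i}b^i\right)}.$$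
   Context: $[k]=\{1,2,\ldots,k\}$, and $[k]^n$ is the set of words $\pi=\pi_1\cdots\pi_n$ of length $n$ over $[k]$ (including the empty word for $n=0$). A gk-connector of $\pi$ is an index $j$ with $1\le j\le n-1$ and $\pi_j+\pi_{j+1}>k$; $\mathrm{gkcon}(\pi)$ is the number of gk-connectors of $\pi$. -}

module Defs where

open import Level using (Level)
open import Data.Bool using (if_then_else_)
open import Data.Nat as ℕ using (ℕ; zero; suc; _∸_; _<ᵇ_)
open import Data.Nat.DivMod using (_/_)
open import Data.Nat.Combinatorics using (_C_)
open import Data.Fin using (Fin; toℕ)
open import Data.Vec using (Vec; []; _∷_)
open import Data.List using (List; []; _∷_; map; concatMap; allFin)
open import Algebra.Bundles using (CommutativeRing)

-- Words of length n over [k], letters encoded as Fin k (letter = toℕ a + 1).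
words : (k n : ℕ) → List (Vec (Fin k) n)
words k zero    = [] ∷ []
words k (suc n) = concatMap (λ a → map (a ∷_) (words k n)) (allFin k)

val : {k : ℕ} → Fin k → ℕ
val a = suc (toℕ a)

gkcon : (k : ℕ) → {n : ℕ} → Vec (Fin k) n → ℕ
gkcon k []               = 0
gkcon k (a ∷ [])         = 0
gkcon k (a ∷ b ∷ rest)   =
  (if k <ᵇ (val a ℕ.+ val b) then 1 else 0) ℕ.+ gkcon k (b ∷ rest)

-- Formal power series in x over a commutative ring R (q is an element of R).
module Series {c ℓ : Level} (R : CommutativeRing c ℓ) where
  open CommutativeRing R

  pow : Carrier → ℕ → Carrier
  pow a zero    = 1#
  pow a (suc n) = a * pow a n

  sgn : ℕ → Carrier
  sgn m = pow (- 1#) m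

  fromℕ : ℕ → Carrier
  fromℕ zero    = 0#
  fromℕ (suc n) = 1# + fromℕ n

  sumFrom : ℕ → ℕ → (ℕ → Carrier) → Carrier
  sumFrom a zero      f = 0#
  sumFrom a (suc len) f = f a + sumFrom (suc a) len f

  -- Σ_{i = lo}^{hi} f i   (empty if hi < lo)
  Σ[_⋯_] : ℕ → ℕ → (ℕ → Carrier) → Carrier
  Σ[ lo ⋯ hi ] f = sumFrom lo (suc hi ∸ lo) f

  PS : Set c
  PS = ℕ → Carrier      -- coefficient sequence: n ↦ [x^n]

  const : Carrier → PS
  const a zero    = a
  const a (suc n) = 0#

  X : PS
  X zero          = 0#
  X (suc zero)    = 1#
  X (suc (suc n)) = 0#

  _⊕_ : PS → PS → PS
  (f ⊕ g) n = f n + g n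

  _⊖_ : PS → PS → PS
  (f ⊖ g) n = f n - g n

  _⊛_ : PS → PS → PS
  (f ⊛ g) n = Σ[ 0 ⋯ n ] (λ m → f m * g (n ∸ m))

  powS : PS → ℕ → PS
  powS f zero    = const 1#
  powS f (suc n) = f ⊛ powS f n

  ΣS[_⋯_] : ℕ → ℕ → (ℕ → PS) → PS
  ΣS[ lo ⋯ hi ] F n = Σ[ lo ⋯ hi ] (λ i → F i n)

  GC : ℕ → Carrier → PS
  GC k q n = sumL (words k n)
    where
    sumL : List (Vec (Fin k) n) → Carrier
    sumL []       = 0#
    sumL (π ∷ πs) = pow q (gkcon k π) + sumL πs

  bS : Carrier → PS
  bS q = X ⊛ const (q - 1#)

  Num : ℕ → Carrier → PS
  Num k q = ΣS[ 0 ⋯ k ] (λ i →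
    const (sgn ((i ℕ.+ 1) / 2) * fromℕ (((k ∸ i) / 2 ℕ.+ i) C i)) ⊛ powS (bS q) i)

  Inner : ℕ → Carrier → PS
  Inner k q = ΣS[ 0 ⋯ k ∸ 1 ] (λ j →
    const 1# ⊕ (const (sgn (j / 2)) ⊛ ΣS[ 1 ⋯ j ] (λ i →
      const (sgn ((j ∸ i) / 2) * fromℕ (((j ∸ i) / 2 ℕ.+ i) C i)) ⊛ powS (bS q) i)))

  Den : ℕ → Carrier → PS
  Den k q = Num k q ⊖ (X ⊛ Inner k q)

{-# OPTIONS --safe #-}
module Submission where

-- Transfer-matrix argument.  Let G_v = Σ x^{|w|-1} q^{gkcon w} over the words w starting with
-- letter v + 1; then GC = 1 + x Σ_v G_v and G_v = GC + b Σ_{u+v+2>k} G_u, with b = x(q - 1).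
-- For k = 2m the polynomials t₀ = t₁ = 1, t_{n+2} = t_n + (-1)ⁿ b t_{n+1} solve the transposed
-- system U_u = N + b Σ_{u+v+2>k} U_v with N = t_{2m+1}.  Pairing the two systems gives
-- N Σ G = GC Σ U, i.e. GC (N - x Σ U) = N, and a Pascal-rule induction identifies the
-- coefficients of N and of Σ U = Σ_{j<k} t_{j+1} with the binomial sums in the statement.

open import Defs
open import Level using (Level)
open import Function using (_∘_; id)
open import Data.Nat as ℕ using (ℕ; zero; suc; _∸_; _≤_; _<_; z≤n; s≤s; ⌊_/2⌋; ⌈_/2⌉; _<ᵇ_)
import Data.Nat.Properties as ℕₚ
open import Data.Nat.DivMod using (_/_; m/n≡1+[m∸n]/n)
open import Data.Nat.Combinatorics using (_C_; nCk+nC[k+1]≡[n+1]C[k+1]; nCn≡1)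
open import Relation.Binary.PropositionalEquality as ≡ using (_≡_; _≢_; cong)
open import Data.Empty using (⊥-elim)
open import Data.Bool using (Bool; true; false; if_then_else_)
open import Relation.Nullary using (yes; no)
open import Algebra.Bundles using (CommutativeRing)
import Algebra.Construct.Pointwise
open import Data.Product using (_,_; ∃-syntax)
open import Data.Fin as Fin using (Fin; toℕ)
open import Data.Vec as Vec using (Vec)
open import Data.List using (List; []; _∷_; _++_; foldr; map; concatMap; allFin)
import Data.List.Properties as Listₚ

module Arithmetic where
  open import Data.Nat using (_+_)
  open ≡ using (refl)
  open ≡.≡-Reasoning

  n/2≡⌊n/2⌋ : ∀ n → n / 2 ≡ ⌊ n /2⌋
  n/2≡⌊n/2⌋ 0             = refl
  n/2≡⌊n/2⌋ 1             = refl
  n/2≡⌊n/2⌋ (suc (suc n)) = ≡.trans (m/n≡1+[m∸n]/n {suc (suc n)} {2} (s≤s (s≤s z≤n))) (cong suc (n/2≡⌊n/2⌋ n))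

  ⌈n+n/2⌉≡n : ∀ n → ⌈ n + n /2⌉ ≡ n
  ⌈n+n/2⌉≡n zero    = refl
  ⌈n+n/2⌉≡n (suc n) = cong suc (≡.trans (cong ⌊_/2⌋ (ℕₚ.+-suc n n)) (⌈n+n/2⌉≡n n))

  ⌈m/2⌉+⌊n/2⌋≡c : ∀ m n c → m + n ≡ c + c → ⌈ m /2⌉ + ⌊ n /2⌋ ≡ c
  ⌈m/2⌉+⌊n/2⌋≡c zero          n c       refl = ≡.sym (ℕₚ.n≡⌊n+n/2⌋ c)
  ⌈m/2⌉+⌊n/2⌋≡c (suc zero)    n (suc c) eq   = cong suc (begin
    ⌊ n /2⌋             ≡⟨ cong ⌊_/2⌋ (ℕₚ.suc-injective (≡.trans eq (ℕₚ.+-suc (suc c) c))) ⟩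
    ⌊ suc (c + c) /2⌋   ≡⟨ ⌈n+n/2⌉≡n c ⟩
    c                   ∎)
  ⌈m/2⌉+⌊n/2⌋≡c (suc (suc m)) n (suc c) eq   =
    cong suc (⌈m/2⌉+⌊n/2⌋≡c m n c (ℕₚ.suc-injective (≡.trans (ℕₚ.suc-injective eq) (ℕₚ.+-suc c c))))
  ⌈m/2⌉+⌊n/2⌋≡c (suc zero)    n zero    ()
  ⌈m/2⌉+⌊n/2⌋≡c (suc (suc m)) n zero    ()

  ⌊m+[2+n]/2⌋≡1+⌊m+n/2⌋ : ∀ m n → ⌊ m + suc (suc n) /2⌋ ≡ suc ⌊ m + n /2⌋
  ⌊m+[2+n]/2⌋≡1+⌊m+n/2⌋ m n = cong ⌊_/2⌋ (≡.trans (ℕₚ.+-suc m (suc n)) (cong suc (ℕₚ.+-suc m n)))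

  pascal : ∀ h i → (h + suc i) C suc i + (suc h + i) C i ≡ (suc h + suc i) C suc i
  pascal h i = begin
    (h + suc i) C suc i + suc (h + i) C i       ≡⟨ cong (λ n → n C suc i + suc (h + i) C i) (ℕₚ.+-suc h i) ⟩
    suc (h + i) C suc i + suc (h + i) C i       ≡⟨ ℕₚ.+-comm (suc (h + i) C suc i) _ ⟩
    suc (h + i) C i + suc (h + i) C suc i       ≡⟨ nCk+nC[k+1]≡[n+1]C[k+1] (suc (h + i)) i ⟩
    suc (suc (h + i)) C suc i                   ≡⟨ cong (λ n → suc n C suc i) (ℕₚ.+-suc h i) ⟨
    suc (h + suc i) C suc i                     ∎

  -- Letter v + 1 of the alphabet [2m] gets the polynomial t (tIndex m v): the letters m, m-1, …, 1
  -- get t₁, t₃, …, t_{2m-1} and the letters m+1, …, 2m get t₂, t₄, …, t_{2m}.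
  tIndex : ℕ → ℕ → ℕ
  tIndex zero    v       = suc v + suc v
  tIndex (suc m) zero    = suc (m + m)
  tIndex (suc m) (suc v) = tIndex m v

  tIndex-low : ∀ v a → tIndex (v + suc a) v ≡ suc (a + a)
  tIndex-low zero    a = refl
  tIndex-low (suc v) a = tIndex-low v a

  tIndex-high : ∀ m a → tIndex m (m + a) ≡ suc a + suc a
  tIndex-high zero    a = refl
  tIndex-high (suc m) a = tIndex-high m a

  2+x≡[1+m]+[1+m]⇒x≡m+m : ∀ {x m} → suc (suc x) ≡ suc m + suc m → x ≡ m + m
  2+x≡[1+m]+[1+m]⇒x≡m+m {x} {m} eq = ℕₚ.suc-injective (≡.trans (ℕₚ.suc-injective eq) (ℕₚ.+-suc m m))

module Powers {c ℓ} (R : CommutativeRing c ℓ) where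
  open CommutativeRing R
  open Series R using (pow; sgn; fromℕ)
  open import Algebra.Properties.Ring ring using (-1*x≈-x; -‿involutive)
  open import Relation.Binary.Reasoning.Setoid setoid

  sgn-suc : ∀ n → sgn (suc n) ≈ - sgn n
  sgn-suc n = -1*x≈-x (sgn n)

  sgn-suc-suc : ∀ n → sgn (suc (suc n)) ≈ sgn n
  sgn-suc-suc n = trans (sgn-suc (suc n)) (trans (-‿cong (sgn-suc n)) (-‿involutive (sgn n)))

  pow-+ : ∀ x a b → pow x (a ℕ.+ b) ≈ pow x a * pow x b
  pow-+ x zero    b = sym (*-identityˡ (pow x b))
  pow-+ x (suc a) b = trans (*-congˡ (pow-+ x a b)) (sym (*-assoc x (pow x a) (pow x b)))

  sgn-+ : ∀ a b → sgn (a ℕ.+ b) ≈ sgn a * sgn b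
  sgn-+ = pow-+ (- 1#)

  sgn-even : ∀ n → sgn (n ℕ.+ n) ≈ 1#
  sgn-even zero    = refl
  sgn-even (suc n) = begin
    sgn (suc (n ℕ.+ suc n))   ≡⟨ cong (sgn ∘ suc) (ℕₚ.+-suc n n) ⟩
    sgn (suc (suc (n ℕ.+ n))) ≈⟨ sgn-suc-suc (n ℕ.+ n) ⟩
    sgn (n ℕ.+ n)             ≈⟨ sgn-even n ⟩
    1#                        ∎

  sgn-odd : ∀ n → sgn (suc (n ℕ.+ n)) ≈ - 1#
  sgn-odd n = trans (sgn-suc (n ℕ.+ n)) (-‿cong (sgn-even n))

  sgn-halves : ∀ n c → sgn n * sgn (⌊ n /2⌋ ℕ.+ c) ≈ sgn (⌈ n /2⌉ ℕ.+ c)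
  sgn-halves zero          c = *-identityˡ (sgn c)
  sgn-halves (suc zero)    c = *-congʳ (*-identityʳ (- 1#))
  sgn-halves (suc (suc n)) c = begin
    sgn (suc (suc n)) * sgn (suc (⌊ n /2⌋ ℕ.+ c)) ≈⟨ *-cong (sgn-suc-suc n) (-1*x≈-x _) ⟩
    sgn n * - sgn (⌊ n /2⌋ ℕ.+ c)                 ≈⟨ -‿distribʳ-* (sgn n) _ ⟨
    - (sgn n * sgn (⌊ n /2⌋ ℕ.+ c))               ≈⟨ -‿cong (sgn-halves n c) ⟩
    - sgn (⌈ n /2⌉ ℕ.+ c)                         ≈⟨ sgn-suc (⌈ n /2⌉ ℕ.+ c) ⟨
    sgn (suc (⌈ n /2⌉ ℕ.+ c))                     ∎
    where open import Algebra.Properties.Ring ring using (-‿distribʳ-*)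

  fromℕ-+ : ∀ a b → fromℕ (a ℕ.+ b) ≈ fromℕ a + fromℕ b
  fromℕ-+ zero    b = sym (+-identityˡ (fromℕ b))
  fromℕ-+ (suc a) b = trans (+-congˡ (fromℕ-+ a b)) (sym (+-assoc 1# (fromℕ a) (fromℕ b)))

module FiniteSums {c ℓ} (R : CommutativeRing c ℓ) where
  open CommutativeRing R
  open Series R using (sumFrom)
  open import Relation.Binary.Reasoning.Setoid setoid

  sumFrom-cong-range : ∀ a l {f g : ℕ → Carrier} →
    (∀ i → a ≤ i → i < a ℕ.+ l → f i ≈ g i) → sumFrom a l f ≈ sumFrom a l g
  sumFrom-cong-range a zero    f≈g = refl
  sumFrom-cong-range a (suc l) f≈g = +-cong (f≈g a ℕₚ.≤-refl a<a+1+l)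
    (sumFrom-cong-range (suc a) l (λ i a<i i<1+a+l → f≈g i (ℕₚ.<⇒≤ a<i) (≡.subst (i <_) (≡.sym (ℕₚ.+-suc a l)) i<1+a+l)))
    where
    a<a+1+l : a < a ℕ.+ suc l
    a<a+1+l = ℕₚ.m<m+n a (s≤s z≤n)

  sumFrom-cong : ∀ a l {f g : ℕ → Carrier} → (∀ i → f i ≈ g i) → sumFrom a l f ≈ sumFrom a l g
  sumFrom-cong a l f≈g = sumFrom-cong-range a l (λ i _ _ → f≈g i)

  sumFrom-0# : ∀ a l → sumFrom a l (λ _ → 0#) ≈ 0#
  sumFrom-0# a zero    = refl
  sumFrom-0# a (suc l) = trans (+-identityˡ _) (sumFrom-0# (suc a) l)

  sumFrom-suc : ∀ a l f → sumFrom (suc a) l f ≡ sumFrom a l (f ∘ suc)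
  sumFrom-suc a zero    f = ≡.refl
  sumFrom-suc a (suc l) f = cong (f (suc a) +_) (sumFrom-suc (suc a) l f)

  sumFrom-offset : ∀ a l f → sumFrom a l f ≡ sumFrom 0 l (λ i → f (a ℕ.+ i))
  sumFrom-offset zero    l f = ≡.refl
  sumFrom-offset (suc a) l f = ≡.trans (sumFrom-suc a l f) (sumFrom-offset a l (f ∘ suc))

  sumFrom-+ : ∀ a l f g → sumFrom a l (λ i → f i + g i) ≈ sumFrom a l f + sumFrom a l g
  sumFrom-+ a zero    f g = sym (+-identityˡ 0#)
  sumFrom-+ a (suc l) f g = trans (+-congˡ (sumFrom-+ (suc a) l f g)) (interchange (f a) (g a) _ _)
    where open import Algebra.Properties.CommutativeSemigroup +-commutativeSemigroup using (interchange)

  *-distribˡ-sumFrom : ∀ x a l f → x * sumFrom a l f ≈ sumFrom a l (λ i → x * f i)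
  *-distribˡ-sumFrom x a zero    f = zeroʳ x
  *-distribˡ-sumFrom x a (suc l) f = trans (distribˡ x (f a) _) (+-congˡ (*-distribˡ-sumFrom x (suc a) l f))

  *-distribʳ-sumFrom : ∀ x a l f → sumFrom a l f * x ≈ sumFrom a l (λ i → f i * x)
  *-distribʳ-sumFrom x a l f = trans (*-comm _ x)
    (trans (*-distribˡ-sumFrom x a l f) (sumFrom-cong a l (λ i → *-comm x (f i))))

  sumFrom-++ : ∀ a l l′ f → sumFrom a (l ℕ.+ l′) f ≈ sumFrom a l f + sumFrom (a ℕ.+ l) l′ f
  sumFrom-++ a zero    l′ f = begin
    sumFrom a l′ f               ≡⟨ cong (λ b → sumFrom b l′ f) (≡.sym (ℕₚ.+-identityʳ a)) ⟩
    sumFrom (a ℕ.+ 0) l′ f       ≈⟨ +-identityˡ _ ⟨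
    0# + sumFrom (a ℕ.+ 0) l′ f  ∎
  sumFrom-++ a (suc l) l′ f = begin
    f a + sumFrom (suc a) (l ℕ.+ l′) f                        ≈⟨ +-congˡ (sumFrom-++ (suc a) l l′ f) ⟩
    f a + (sumFrom (suc a) l f + sumFrom (suc a ℕ.+ l) l′ f)  ≈⟨ +-assoc (f a) _ _ ⟨
    f a + sumFrom (suc a) l f + sumFrom (suc a ℕ.+ l) l′ f    ≡⟨ cong (λ b → f a + sumFrom (suc a) l f + sumFrom b l′ f) (≡.sym (ℕₚ.+-suc a l)) ⟩
    f a + sumFrom (suc a) l f + sumFrom (a ℕ.+ suc l) l′ f    ∎

  sumFrom-last : ∀ a l f → sumFrom a (suc l) f ≈ sumFrom a l f + f (a ℕ.+ l)
  sumFrom-last a l f = begin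
    sumFrom a (suc l) f                 ≡⟨ cong (λ n → sumFrom a n f) (ℕₚ.+-comm 1 l) ⟩
    sumFrom a (l ℕ.+ 1) f               ≈⟨ sumFrom-++ a l 1 f ⟩
    sumFrom a l f + (f (a ℕ.+ l) + 0#)  ≈⟨ +-congˡ (+-identityʳ _) ⟩
    sumFrom a l f + f (a ℕ.+ l)         ∎

  sumFrom-swap : ∀ a l b l′ (H : ℕ → ℕ → Carrier) →
    sumFrom a l (λ i → sumFrom b l′ (H i)) ≈ sumFrom b l′ (λ j → sumFrom a l (λ i → H i j))
  sumFrom-swap a zero    b l′ H = sym (sumFrom-0# b l′)
  sumFrom-swap a (suc l) b l′ H = begin
    sumFrom b l′ (H a) + sumFrom (suc a) l (λ i → sumFrom b l′ (H i))          ≈⟨ +-congˡ (sumFrom-swap (suc a) l b l′ H) ⟩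
    sumFrom b l′ (H a) + sumFrom b l′ (λ j → sumFrom (suc a) l (λ i → H i j))  ≈⟨ sumFrom-+ b l′ _ _ ⟨
    sumFrom b l′ (λ j → H a j + sumFrom (suc a) l (λ i → H i j))               ∎

  sumFrom-reverse : ∀ l f → sumFrom 0 l (λ i → f (l ∸ suc i)) ≈ sumFrom 0 l f
  sumFrom-reverse zero    f = refl
  sumFrom-reverse (suc l) f = begin
    f l + sumFrom 1 l (λ i → f (suc l ∸ suc i))  ≡⟨ cong (f l +_) (sumFrom-suc 0 l _) ⟩
    f l + sumFrom 0 l (λ i → f (l ∸ suc i))      ≈⟨ +-congˡ (sumFrom-reverse l f) ⟩
    f l + sumFrom 0 l f                          ≈⟨ +-comm _ _ ⟩
    sumFrom 0 l f + f l                          ≈⟨ sumFrom-last 0 l f ⟨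
    sumFrom 0 (suc l) f                          ∎

  sumFrom-pairs : ∀ l f → sumFrom 0 (l ℕ.+ l) f ≈ sumFrom 0 l (λ i → f (i ℕ.+ i) + f (suc (i ℕ.+ i)))
  sumFrom-pairs zero    f = refl
  sumFrom-pairs (suc l) f = begin
    sumFrom 0 (suc l ℕ.+ suc l) f                               ≡⟨ cong (λ n → sumFrom 0 (suc n) f) (ℕₚ.+-suc l l) ⟩
    sumFrom 0 (suc (suc (l ℕ.+ l))) f                           ≈⟨ sumFrom-last 0 (suc (l ℕ.+ l)) f ⟩
    sumFrom 0 (suc (l ℕ.+ l)) f + f (suc (l ℕ.+ l))             ≈⟨ +-congʳ (sumFrom-last 0 (l ℕ.+ l) f) ⟩
    sumFrom 0 (l ℕ.+ l) f + f (l ℕ.+ l) + f (suc (l ℕ.+ l))     ≈⟨ +-assoc _ _ _ ⟩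
    sumFrom 0 (l ℕ.+ l) f + (f (l ℕ.+ l) + f (suc (l ℕ.+ l)))   ≈⟨ +-congʳ (sumFrom-pairs l f) ⟩
    sumFrom 0 l g + g l                                         ≈⟨ sumFrom-last 0 l g ⟨
    sumFrom 0 (suc l) g                                         ∎
    where
    g : ℕ → Carrier
    g i = f (i ℕ.+ i) + f (suc (i ℕ.+ i))

  δ : ℕ → ℕ → Carrier
  δ zero    zero    = 1#
  δ zero    (suc n) = 0#
  δ (suc i) zero    = 0#
  δ (suc i) (suc n) = δ i n

  δ-diagonal : ∀ n → δ n n ≈ 1#
  δ-diagonal zero    = refl
  δ-diagonal (suc n) = δ-diagonal n

  δ-offDiagonal : ∀ {i n} → i ≢ n → δ i n ≈ 0#
  δ-offDiagonal {zero}  {zero}  i≢n = ⊥-elim (i≢n ≡.refl)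
  δ-offDiagonal {zero}  {suc n} i≢n = refl
  δ-offDiagonal {suc i} {zero}  i≢n = refl
  δ-offDiagonal {suc i} {suc n} i≢n = δ-offDiagonal (i≢n ∘ cong suc)

  sumFrom-δ-outside : ∀ a l (g : ℕ → Carrier) {n} → (∀ i → a ≤ i → i < a ℕ.+ l → i ≢ n) →
    sumFrom a l (λ i → g i * δ i n) ≈ 0#
  sumFrom-δ-outside a l g i≢n = trans
    (sumFrom-cong-range a l (λ i a≤i i<a+l → trans (*-congˡ (δ-offDiagonal (i≢n i a≤i i<a+l))) (zeroʳ (g i))))
    (sumFrom-0# a l)

  sumFrom-δ : ∀ a l (g : ℕ → Carrier) {n} → a ≤ n → n < a ℕ.+ l → sumFrom a l (λ i → g i * δ i n) ≈ g n
  sumFrom-δ a zero    g {n} a≤n n<a+0 = ⊥-elim (ℕₚ.<⇒≱ (≡.subst (n <_) (ℕₚ.+-identityʳ a) n<a+0) a≤n)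
  sumFrom-δ a (suc l) g {n} a≤n n<a+1+l with a ℕ.≟ n
  ... | yes ≡.refl = trans
    (+-cong (trans (*-congˡ (δ-diagonal a)) (*-identityʳ (g a)))
            (sumFrom-δ-outside (suc a) l g (λ i a<i _ i≡a → ℕₚ.<⇒≢ a<i (≡.sym i≡a))))
    (+-identityʳ (g a))
  ... | no a≢n = trans
    (+-cong (trans (*-congˡ (δ-offDiagonal a≢n)) (zeroʳ (g a)))
            (sumFrom-δ (suc a) l g (ℕₚ.≤∧≢⇒< a≤n a≢n) (≡.subst (n <_) (ℕₚ.+-suc a l) n<a+1+l)))
    (+-identityˡ (g n))

  sumList : ∀ {a} {A : Set a} → (A → Carrier) → List A → Carrier
  sumList f = foldr (λ x s → f x + s) 0#

  sumList-cong : ∀ {a} {A : Set a} {f g : A → Carrier} xs → (∀ x → f x ≈ g x) → sumList f xs ≈ sumList g xs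
  sumList-cong []       f≈g = refl
  sumList-cong (x ∷ xs) f≈g = +-cong (f≈g x) (sumList-cong xs f≈g)

  sumList-++ : ∀ {a} {A : Set a} (f : A → Carrier) xs ys → sumList f (xs ++ ys) ≈ sumList f xs + sumList f ys
  sumList-++ f []       ys = sym (+-identityˡ _)
  sumList-++ f (x ∷ xs) ys = trans (+-congˡ (sumList-++ f xs ys)) (sym (+-assoc (f x) _ _))

  *-distribˡ-sumList : ∀ {a} {A : Set a} y (f : A → Carrier) xs → y * sumList f xs ≈ sumList (λ x → y * f x) xs
  *-distribˡ-sumList y f []       = zeroʳ y
  *-distribˡ-sumList y f (x ∷ xs) = trans (distribˡ y (f x) _) (+-congˡ (*-distribˡ-sumList y f xs))

  sumList-map : ∀ {a b} {A : Set a} {B : Set b} (f : B → Carrier) (g : A → B) xs → sumList f (map g xs) ≡ sumList (f ∘ g) xs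
  sumList-map f g []       = ≡.refl
  sumList-map f g (x ∷ xs) = cong (f (g x) +_) (sumList-map f g xs)

  sumList-concatMap : ∀ {a b} {A : Set a} {B : Set b} (f : B → Carrier) (g : A → List B) xs →
    sumList f (concatMap g xs) ≈ sumList (sumList f ∘ g) xs
  sumList-concatMap f g []       = refl
  sumList-concatMap f g (x ∷ xs) = trans (sumList-++ f (g x) (concatMap g xs)) (+-congˡ (sumList-concatMap f g xs))

  sumList-allFin : ∀ n (f : ℕ → Carrier) → sumList (f ∘ toℕ) (allFin n) ≈ sumFrom 0 n f
  sumList-allFin zero    f = refl
  sumList-allFin (suc n) f = begin
    f 0 + sumList (f ∘ toℕ) (Data.List.tabulate {n = n} Fin.suc)
                                         ≡⟨ cong (λ xs → f 0 + sumList (f ∘ toℕ) xs) (Listₚ.map-tabulate {n = n} id Fin.suc) ⟨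
    f 0 + sumList (f ∘ toℕ) (map Fin.suc (allFin n))         ≡⟨ cong (f 0 +_) (sumList-map (f ∘ toℕ) Fin.suc (allFin n)) ⟩
    f 0 + sumList (f ∘ suc ∘ toℕ) (allFin n)                 ≈⟨ +-congˡ (sumList-allFin n (f ∘ suc)) ⟩
    f 0 + sumFrom 0 n (f ∘ suc)                              ≡⟨ cong (f 0 +_) (sumFrom-suc 0 n f) ⟨
    sumFrom 0 (suc n) f                                      ∎

module LinearSystems {c ℓ} (A : CommutativeRing c ℓ) where
  open CommutativeRing A
  open Series A using (sumFrom)
  open FiniteSums A
  open import Algebra.Properties.Ring ring using (+-cancelʳ)
  open import Algebra.Solver.Ring.NaturalCoefficients.Default commutativeSemiring using (solve; _:+_; _:*_; _:=_)
  open import Relation.Binary.Reasoning.Setoid setoid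
  open import Data.Bool using (T)

  indicator : Bool → Carrier
  indicator true  = 1#
  indicator false = 0#

  sumFrom-indicator : ∀ k u w (f : ℕ → Carrier) → w ℕ.+ suc u ≡ k →
    sumFrom 0 k (λ v → indicator (k <ᵇ suc v ℕ.+ suc u) * f v) ≈ sumFrom w (suc u) f
  sumFrom-indicator _ u w f ≡.refl = begin
    sumFrom 0 (w ℕ.+ suc u) h                  ≈⟨ sumFrom-++ 0 w (suc u) h ⟩
    sumFrom 0 w h + sumFrom w (suc u) h        ≈⟨ +-cong (trans (sumFrom-cong-range 0 w below) (sumFrom-0# 0 w))
                                                         (sumFrom-cong-range w (suc u) above) ⟩
    0# + sumFrom w (suc u) f                   ≈⟨ +-identityˡ _ ⟩
    sumFrom w (suc u) f                        ∎
    where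
    k = w ℕ.+ suc u
    h : ℕ → Carrier
    h v = indicator (k <ᵇ suc v ℕ.+ suc u) * f v
    below : ∀ v → 0 ≤ v → v < w → h v ≈ 0#
    below v _ v<w with k <ᵇ suc v ℕ.+ suc u in connected
    ... | true  = ⊥-elim (ℕₚ.<⇒≱ (ℕₚ.<ᵇ⇒< k (suc v ℕ.+ suc u) (≡.subst T (≡.sym connected) _))
                                 (ℕₚ.+-monoˡ-≤ (suc u) v<w))
    ... | false = zeroˡ (f v)
    above : ∀ v → w ≤ v → v < w ℕ.+ suc u → h v ≈ f v
    above v w≤v _ with k <ᵇ suc v ℕ.+ suc u in connected
    ... | true  = *-identityˡ (f v)
    ... | false = ⊥-elim (≡.subst T connected (ℕₚ.<⇒<ᵇ (s≤s (ℕₚ.+-monoˡ-≤ (suc u) w≤v))))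

  suffix-sums : ∀ k (U : ℕ → Carrier) N β →
    (∀ w → suc w ≡ k → U 0 ≈ N + β * U w) →
    (∀ u w → suc (suc (u ℕ.+ w)) ≡ k → U (suc u) ≈ U u + β * U w) →
    ∀ u w → w ℕ.+ suc u ≡ k → U u ≈ N + β * sumFrom w (suc u) U
  suffix-sums k U N β first step zero w w+1≡k = begin
    U 0                    ≈⟨ first w (≡.trans (ℕₚ.+-comm 1 w) w+1≡k) ⟩
    N + β * U w            ≈⟨ +-congˡ (*-congˡ (+-identityʳ (U w))) ⟨
    N + β * (U w + 0#)     ∎
  suffix-sums k U N β first step (suc u) w w+2+u≡k = begin
    U (suc u)                                     ≈⟨ step u w step-index ⟩
    U u + β * U w                                 ≈⟨ +-congʳ (suffix-sums k U N β first step u (suc w) suffix-index) ⟩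
    N + β * S + β * U w                           ≈⟨ solve 4 (λ N β S x → (N :+ β :* S :+ β :* x) := (N :+ β :* (x :+ S)))
                                                             refl N β S (U w) ⟩
    N + β * (U w + S)                             ∎
    where
    S = sumFrom (suc w) (suc u) U
    suffix-index : suc w ℕ.+ suc u ≡ k
    suffix-index = ≡.trans (≡.sym (ℕₚ.+-suc w (suc u))) w+2+u≡k
    step-index : suc (suc (u ℕ.+ w)) ≡ k
    step-index = ≡.trans (cong (suc ∘ suc) (ℕₚ.+-comm u w))
      (≡.trans (≡.sym (≡.trans (ℕₚ.+-suc w (suc u)) (cong suc (ℕₚ.+-suc w u)))) w+2+u≡k)

  -- Expanding Σ_v U_v G_v with either system leaves the same double sum D.
  dual-systems : ∀ k (M : ℕ → ℕ → Carrier) (β g N : Carrier) (G U : ℕ → Carrier) →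
    (∀ v → v < k → G v ≈ g + β * sumFrom 0 k (λ u → M v u * G u)) →
    (∀ u → u < k → U u ≈ N + β * sumFrom 0 k (λ v → M v u * U v)) →
    N * sumFrom 0 k G ≈ sumFrom 0 k U * g
  dual-systems k M β g N G U G-solves U-solves = +-cancelʳ D _ _ (begin
    N * sumFrom 0 k G + D                 ≈⟨ U-side ⟨
    sumFrom 0 k (λ v → U v * G v)         ≈⟨ G-side ⟩
    sumFrom 0 k U * g + D                 ∎)
    where
    term : ℕ → ℕ → Carrier
    term v u = β * (M v u * (U v * G u))
    D = sumFrom 0 k (λ v → sumFrom 0 k (term v))

    G-side : sumFrom 0 k (λ v → U v * G v) ≈ sumFrom 0 k U * g + D
    G-side = begin
      sumFrom 0 k (λ v → U v * G v)                       ≈⟨ sumFrom-cong-range 0 k (λ v _ v<k → *-congˡ (G-solves v v<k)) ⟩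
      sumFrom 0 k (λ v → U v * (g + β * ΣMG v))           ≈⟨ sumFrom-cong 0 k (λ v → trans (distribˡ (U v) g _) (+-congˡ (expand v))) ⟩
      sumFrom 0 k (λ v → U v * g + sumFrom 0 k (term v))  ≈⟨ sumFrom-+ 0 k _ _ ⟩
      sumFrom 0 k (λ v → U v * g) + D                     ≈⟨ +-congʳ (*-distribʳ-sumFrom g 0 k U) ⟨
      sumFrom 0 k U * g + D                               ∎
      where
      ΣMG : ℕ → Carrier
      ΣMG v = sumFrom 0 k (λ u → M v u * G u)
      expand : ∀ v → U v * (β * ΣMG v) ≈ sumFrom 0 k (term v)
      expand v = begin
        U v * (β * ΣMG v)                              ≈⟨ *-congˡ (*-distribˡ-sumFrom β 0 k _) ⟩
        U v * sumFrom 0 k (λ u → β * (M v u * G u))    ≈⟨ *-distribˡ-sumFrom (U v) 0 k _ ⟩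
        sumFrom 0 k (λ u → U v * (β * (M v u * G u)))  ≈⟨ sumFrom-cong 0 k (λ u → rearrange (U v) β (M v u) (G u)) ⟩
        sumFrom 0 k (term v)                           ∎
        where
        rearrange : ∀ x β y z → x * (β * (y * z)) ≈ β * (y * (x * z))
        rearrange = solve 4 (λ x β y z → (x :* (β :* (y :* z))) := (β :* (y :* (x :* z)))) refl

    U-side : sumFrom 0 k (λ u → U u * G u) ≈ N * sumFrom 0 k G + D
    U-side = begin
      sumFrom 0 k (λ u → U u * G u)                             ≈⟨ sumFrom-cong-range 0 k (λ u _ u<k → *-congʳ (U-solves u u<k)) ⟩
      sumFrom 0 k (λ u → (N + β * ΣMU u) * G u)                 ≈⟨ sumFrom-cong 0 k (λ u → trans (distribʳ (G u) N _) (+-congˡ (expand u))) ⟩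
      sumFrom 0 k (λ u → N * G u + sumFrom 0 k (λ v → term v u)) ≈⟨ sumFrom-+ 0 k _ _ ⟩
      sumFrom 0 k (λ u → N * G u) + sumFrom 0 k (λ u → sumFrom 0 k (λ v → term v u))
                                                                ≈⟨ +-cong (*-distribˡ-sumFrom N 0 k G) (sumFrom-swap 0 k 0 k term) ⟨
      N * sumFrom 0 k G + D                                     ∎
      where
      ΣMU : ℕ → Carrier
      ΣMU u = sumFrom 0 k (λ v → M v u * U v)
      expand : ∀ u → β * ΣMU u * G u ≈ sumFrom 0 k (λ v → term v u)
      expand u = begin
        β * ΣMU u * G u                                ≈⟨ *-congʳ (*-distribˡ-sumFrom β 0 k _) ⟩
        sumFrom 0 k (λ v → β * (M v u * U v)) * G u    ≈⟨ *-distribʳ-sumFrom (G u) 0 k _ ⟩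
        sumFrom 0 k (λ v → β * (M v u * U v) * G u)    ≈⟨ sumFrom-cong 0 k (λ v → rearrange (U v) β (M v u) (G u)) ⟩
        sumFrom 0 k (λ v → term v u)                   ∎
        where
        rearrange : ∀ x β y z → β * (y * x) * z ≈ β * (y * (x * z))
        rearrange = solve 4 (λ x β y z → (β :* (y :* x) :* z) := (β :* (y :* (x :* z)))) refl

module PowerSeries {c ℓ} (R : CommutativeRing c ℓ) where
  open CommutativeRing R
  open Series R
  open FiniteSums R
  open import Relation.Binary.Reasoning.Setoid setoid

  infix 4 _≋_
  _≋_ : PS → PS → Set ℓ
  f ≋ g = ∀ n → f n ≈ g n

  tail : PS → PS
  tail f n = f (suc n)

  infixr 7 _·_
  _·_ : Carrier → PS → PS
  (a · f) n = a * f n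

  ⊛-head : ∀ f g → (f ⊛ g) 0 ≈ f 0 * g 0
  ⊛-head f g = +-identityʳ (f 0 * g 0)

  ⊛-tail : ∀ f g n → (f ⊛ g) (suc n) ≡ f 0 * g (suc n) + (tail f ⊛ g) n
  ⊛-tail f g n = cong (f 0 * g (suc n) +_) (sumFrom-suc 0 (suc n) (λ m → f m * g (suc n ∸ m)))

  ⊛-cong : ∀ {f f′ g g′} → f ≋ f′ → g ≋ g′ → f ⊛ g ≋ f′ ⊛ g′
  ⊛-cong f≋f′ g≋g′ n = sumFrom-cong 0 (suc n) (λ m → *-cong (f≋f′ m) (g≋g′ (n ∸ m)))

  ⊛-comm : ∀ f g → f ⊛ g ≋ g ⊛ f
  ⊛-comm f g n = begin
    sumFrom 0 (suc n) (λ i → f i * g (n ∸ i))               ≈⟨ sumFrom-cong-range 0 (suc n) reflect ⟩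
    sumFrom 0 (suc n) (λ i → g (n ∸ i) * f (n ∸ (n ∸ i)))   ≈⟨ sumFrom-reverse (suc n) (λ j → g j * f (n ∸ j)) ⟩
    sumFrom 0 (suc n) (λ j → g j * f (n ∸ j))               ∎
    where
    reflect : ∀ i → 0 ≤ i → i < suc n → f i * g (n ∸ i) ≈ g (n ∸ i) * f (n ∸ (n ∸ i))
    reflect i _ i<1+n = trans (*-comm (f i) _) (*-congˡ (reflexive (cong f (≡.sym (ℕₚ.m∸[m∸n]≡n (ℕₚ.≤-pred i<1+n))))))

  ⊛-distribˡ : ∀ f g h → f ⊛ (g ⊕ h) ≋ (f ⊛ g) ⊕ (f ⊛ h)
  ⊛-distribˡ f g h n = trans (sumFrom-cong 0 (suc n) (λ i → distribˡ (f i) _ _)) (sumFrom-+ 0 (suc n) _ _)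

  ⊛-distribʳ : ∀ h f g → (f ⊕ g) ⊛ h ≋ (f ⊛ h) ⊕ (g ⊛ h)
  ⊛-distribʳ h f g n = begin
    ((f ⊕ g) ⊛ h) n           ≈⟨ ⊛-comm (f ⊕ g) h n ⟩
    (h ⊛ (f ⊕ g)) n           ≈⟨ ⊛-distribˡ h f g n ⟩
    (h ⊛ f) n + (h ⊛ g) n     ≈⟨ +-cong (⊛-comm h f n) (⊛-comm h g n) ⟩
    (f ⊛ h) n + (g ⊛ h) n     ∎

  ·-⊛ : ∀ a f g → (a · f) ⊛ g ≋ a · (f ⊛ g)
  ·-⊛ a f g n = trans (sumFrom-cong 0 (suc n) (λ i → *-assoc a (f i) _)) (sym (*-distribˡ-sumFrom a 0 (suc n) _))

  const-⊛ : ∀ a f → const a ⊛ f ≋ a · f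
  const-⊛ a f zero    = ⊛-head (const a) f
  const-⊛ a f (suc n) = begin
    (const a ⊛ f) (suc n)                    ≡⟨ ⊛-tail (const a) f n ⟩
    a * f (suc n) + (tail (const a) ⊛ f) n   ≈⟨ +-congˡ (trans (sumFrom-cong 0 (suc n) (λ i → zeroˡ _)) (sumFrom-0# 0 (suc n))) ⟩
    a * f (suc n) + 0#                       ≈⟨ +-identityʳ _ ⟩
    a * f (suc n)                            ∎

  ⊛-assoc : ∀ f g h → (f ⊛ g) ⊛ h ≋ f ⊛ (g ⊛ h)
  ⊛-assoc f g h zero = begin
    ((f ⊛ g) ⊛ h) 0      ≈⟨ ⊛-head (f ⊛ g) h ⟩
    (f ⊛ g) 0 * h 0      ≈⟨ *-congʳ (⊛-head f g) ⟩
    f 0 * g 0 * h 0      ≈⟨ *-assoc (f 0) (g 0) (h 0) ⟩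
    f 0 * (g 0 * h 0)    ≈⟨ *-congˡ (⊛-head g h) ⟨
    f 0 * (g ⊛ h) 0      ≈⟨ ⊛-head f (g ⊛ h) ⟨
    (f ⊛ (g ⊛ h)) 0      ∎
  ⊛-assoc f g h (suc n) = begin
    ((f ⊛ g) ⊛ h) (suc n)                                              ≡⟨ ⊛-tail (f ⊛ g) h n ⟩
    (f ⊛ g) 0 * h (suc n) + (tail (f ⊛ g) ⊛ h) n                       ≈⟨ +-cong (*-congʳ (⊛-head f g)) (⊛-cong {g = h} tail-⊛ (λ _ → refl) n) ⟩
    f 0 * g 0 * h (suc n) + (((f 0 · tail g) ⊕ (tail f ⊛ g)) ⊛ h) n    ≈⟨ +-congˡ (⊛-distribʳ h _ _ n) ⟩
    f 0 * g 0 * h (suc n) + (((f 0 · tail g) ⊛ h) n + ((tail f ⊛ g) ⊛ h) n)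
                                                                       ≈⟨ +-congˡ (+-cong (·-⊛ (f 0) (tail g) h n) (⊛-assoc (tail f) g h n)) ⟩
    f 0 * g 0 * h (suc n) + (f 0 * (tail g ⊛ h) n + (tail f ⊛ (g ⊛ h)) n)
                                                                       ≈⟨ +-congʳ (*-assoc (f 0) (g 0) (h (suc n))) ⟩
    f 0 * (g 0 * h (suc n)) + (f 0 * (tail g ⊛ h) n + (tail f ⊛ (g ⊛ h)) n)
                                                                       ≈⟨ +-assoc _ _ _ ⟨
    f 0 * (g 0 * h (suc n)) + f 0 * (tail g ⊛ h) n + (tail f ⊛ (g ⊛ h)) n
                                                                       ≈⟨ +-congʳ (distribˡ (f 0) _ _) ⟨
    f 0 * (g 0 * h (suc n) + (tail g ⊛ h) n) + (tail f ⊛ (g ⊛ h)) n    ≡⟨ cong (λ x → f 0 * x + (tail f ⊛ (g ⊛ h)) n) (≡.sym (⊛-tail g h n)) ⟩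
    f 0 * (g ⊛ h) (suc n) + (tail f ⊛ (g ⊛ h)) n                       ≡⟨ ⊛-tail f (g ⊛ h) n ⟨
    (f ⊛ (g ⊛ h)) (suc n)                                              ∎
    where
    tail-⊛ : tail (f ⊛ g) ≋ (f 0 · tail g) ⊕ (tail f ⊛ g)
    tail-⊛ m = reflexive (⊛-tail f g m)

  X-⊛-head : ∀ f → (X ⊛ f) 0 ≈ 0#
  X-⊛-head f = trans (⊛-head X f) (zeroˡ (f 0))

  X-⊛-tail : ∀ f n → (X ⊛ f) (suc n) ≈ f n
  X-⊛-tail f n = begin
    (X ⊛ f) (suc n)                ≡⟨ ⊛-tail X f n ⟩
    0# * f (suc n) + (tail X ⊛ f) n ≈⟨ +-cong (zeroˡ (f (suc n))) (⊛-cong {g = f} tail-X (λ _ → refl) n) ⟩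
    0# + (const 1# ⊛ f) n           ≈⟨ +-identityˡ _ ⟩
    (const 1# ⊛ f) n                ≈⟨ const-⊛ 1# f n ⟩
    1# * f n                        ≈⟨ *-identityˡ (f n) ⟩
    f n                             ∎
    where
    tail-X : tail X ≋ const 1#
    tail-X zero    = refl
    tail-X (suc n) = refl

  -- Its operations are definitionally those of Series, so ring lemmas apply verbatim to GC, Num, Den.
  powerSeriesRing : CommutativeRing c ℓ
  powerSeriesRing = record
    { Carrier           = PS
    ; _≈_               = _≋_
    ; _+_               = _⊕_
    ; _*_               = _⊛_
    ; -_                = λ f n → - f n
    ; 0#                = λ _ → 0#
    ; 1#                = const 1#
    ; isCommutativeRing = record
      { isRing = record
        { +-isAbelianGroup = Pointwise.isAbelianGroup +-isAbelianGroup
        ; *-cong           = ⊛-cong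
        ; *-assoc          = ⊛-assoc
        ; *-identity       = 1-⊛ , λ f n → trans (⊛-comm f (const 1#) n) (1-⊛ f n)
        ; distrib          = ⊛-distribˡ , ⊛-distribʳ
        }
      ; *-comm = ⊛-comm
      }
    }
    where
    module Pointwise = Algebra.Construct.Pointwise ℕ
    1-⊛ : ∀ f → const 1# ⊛ f ≋ f
    1-⊛ f n = trans (const-⊛ 1# f n) (*-identityˡ (f n))

  open Series powerSeriesRing public using () renaming (sumFrom to sumFromS)

  sumFromS-coeff : ∀ a l F n → sumFromS a l F n ≡ sumFrom a l (λ i → F i n)
  sumFromS-coeff a zero    F n = ≡.refl
  sumFromS-coeff a (suc l) F n = cong (F a n +_) (sumFromS-coeff (suc a) l F n)

module TPolynomials {c ℓ} (R : CommutativeRing c ℓ) where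
  open CommutativeRing R
  open Series R using (sgn; fromℕ; sumFrom)
  open Powers R
  open FiniteSums R
  open Arithmetic
  open import Relation.Binary.Reasoning.Setoid setoid

  shift : (ℕ → Carrier) → ℕ → Carrier
  shift p zero    = 0#
  shift p (suc n) = p n

  -- t n i is the coefficient of bⁱ in t_n(b); Num is t_{k+1} and the j-th summand of Inner is t_{j+1}.
  t : ℕ → ℕ → Carrier
  t zero            = δ 0
  t (suc zero)      = δ 0
  t (suc (suc n)) i = t n i + sgn n * shift (t (suc n)) i

  t-constant : ∀ n → t n 0 ≈ 1#
  t-constant zero          = refl
  t-constant (suc zero)    = refl
  t-constant (suc (suc n)) = trans (+-cong (t-constant n) (zeroʳ (sgn n))) (+-identityʳ 1#)

  t-vanishes : ∀ {n i} → n ≤ suc i → t n (suc i) ≈ 0#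
  t-vanishes {zero}                 _                = refl
  t-vanishes {suc zero}             _                = refl
  t-vanishes {suc (suc n)} {zero}   (s≤s ())
  t-vanishes {suc (suc n)} {suc i}  (s≤s 1+n≤1+i) = begin
    t n (suc (suc i)) + sgn n * t (suc n) (suc i)   ≈⟨ +-cong (t-vanishes (ℕₚ.≤-trans (ℕₚ.n≤1+n n) (ℕₚ.m≤n⇒m≤1+n 1+n≤1+i)))
                                                               (*-congˡ (t-vanishes 1+n≤1+i)) ⟩
    0# + sgn n * 0#                                 ≈⟨ +-identityˡ _ ⟩
    sgn n * 0#                                      ≈⟨ zeroʳ (sgn n) ⟩
    0#                                              ∎

  fromℕ-iCi : ∀ i → fromℕ (i C i) ≈ fromℕ (suc i C suc i)
  fromℕ-iCi i = reflexive (cong fromℕ (≡.trans (nCn≡1 i) (≡.sym (nCn≡1 (suc i)))))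

  closedCoeff : ℕ → ℕ → Carrier
  closedCoeff i e = sgn (⌊ i ℕ.+ e /2⌋ ℕ.+ ⌊ e /2⌋) * fromℕ ((⌊ e /2⌋ ℕ.+ i) C i)

  t≈closedCoeff : ∀ i e → t (suc (i ℕ.+ e)) i ≈ closedCoeff i e
  closedCoeff-recurrence : ∀ i e → t (i ℕ.+ e) (suc i) + sgn (⌈ i ℕ.+ e /2⌉ ℕ.+ ⌊ e /2⌋) * fromℕ ((⌊ e /2⌋ ℕ.+ i) C i)
                              ≈ closedCoeff (suc i) e

  t≈closedCoeff zero    e = begin
    t (suc e) 0                                   ≈⟨ t-constant (suc e) ⟩
    1#                                            ≈⟨ *-identityˡ 1# ⟨
    1# * 1#                                       ≈⟨ *-cong (sgn-even ⌊ e /2⌋) (+-identityʳ 1#) ⟨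
    sgn (⌊ e /2⌋ ℕ.+ ⌊ e /2⌋) * fromℕ 1           ∎
  t≈closedCoeff (suc i) e = begin
    t (i ℕ.+ e) (suc i) + sgn (i ℕ.+ e) * t (suc (i ℕ.+ e)) i            ≈⟨ +-congˡ (*-congˡ (t≈closedCoeff i e)) ⟩
    t (i ℕ.+ e) (suc i) + sgn (i ℕ.+ e) * (sgn (⌊ i ℕ.+ e /2⌋ ℕ.+ ⌊ e /2⌋) * B)
                                                                         ≈⟨ +-congˡ (*-assoc _ _ B) ⟨
    t (i ℕ.+ e) (suc i) + sgn (i ℕ.+ e) * sgn (⌊ i ℕ.+ e /2⌋ ℕ.+ ⌊ e /2⌋) * B
                                                                         ≈⟨ +-congˡ (*-congʳ (sgn-halves (i ℕ.+ e) ⌊ e /2⌋)) ⟩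
    t (i ℕ.+ e) (suc i) + sgn (⌈ i ℕ.+ e /2⌉ ℕ.+ ⌊ e /2⌋) * B            ≈⟨ closedCoeff-recurrence i e ⟩
    closedCoeff (suc i) e                                                ∎
    where
    B = fromℕ ((⌊ e /2⌋ ℕ.+ i) C i)

  closedCoeff-recurrence i zero          =
    trans (+-cong (t-vanishes (ℕₚ.≤-trans (ℕₚ.≤-reflexive (ℕₚ.+-identityʳ i)) (ℕₚ.n≤1+n i))) (*-congˡ (fromℕ-iCi i)))
          (+-identityˡ _)
  closedCoeff-recurrence i (suc zero)    =
    trans (+-cong (t-vanishes (ℕₚ.≤-reflexive (ℕₚ.+-comm i 1))) (*-congˡ (fromℕ-iCi i))) (+-identityˡ _)
  closedCoeff-recurrence i (suc (suc e)) = begin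
    t (i ℕ.+ suc (suc e)) (suc i) + S * B₂                 ≡⟨ cong (λ n → t n (suc i) + S * B₂) (ℕₚ.+-suc i (suc e)) ⟩
    t (suc (i ℕ.+ suc e)) (suc i) + S * B₂                 ≡⟨ cong (λ n → t (suc n) (suc i) + S * B₂) (ℕₚ.+-suc i e) ⟩
    t (suc (suc i ℕ.+ e)) (suc i) + S * B₂                 ≈⟨ +-congʳ (t≈closedCoeff (suc i) e) ⟩
    sgn (⌊ suc i ℕ.+ e /2⌋ ℕ.+ ⌊ e /2⌋) * B₁ + S * B₂      ≈⟨ +-congʳ (*-congʳ sign) ⟩
    S * B₁ + S * B₂                                        ≈⟨ distribˡ S B₁ B₂ ⟨
    S * (B₁ + B₂)                                          ≈⟨ *-congˡ (fromℕ-+ ((⌊ e /2⌋ ℕ.+ suc i) C suc i) ((suc ⌊ e /2⌋ ℕ.+ i) C i)) ⟨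
    S * fromℕ ((⌊ e /2⌋ ℕ.+ suc i) C suc i ℕ.+ (suc ⌊ e /2⌋ ℕ.+ i) C i)
                                                           ≡⟨ cong (λ n → S * fromℕ n) (pascal ⌊ e /2⌋ i) ⟩
    closedCoeff (suc i) (suc (suc e))                      ∎
    where
    S  = sgn (⌈ i ℕ.+ suc (suc e) /2⌉ ℕ.+ suc ⌊ e /2⌋)
    B₁ = fromℕ ((⌊ e /2⌋ ℕ.+ suc i) C suc i)
    B₂ = fromℕ ((suc ⌊ e /2⌋ ℕ.+ i) C i)
    X  = ⌊ suc i ℕ.+ e /2⌋
    sign : sgn (X ℕ.+ ⌊ e /2⌋) ≈ S
    sign = begin
      sgn (X ℕ.+ ⌊ e /2⌋)                  ≈⟨ sgn-suc-suc (X ℕ.+ ⌊ e /2⌋) ⟨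
      sgn (suc (suc (X ℕ.+ ⌊ e /2⌋)))      ≡⟨ cong (sgn ∘ suc) (ℕₚ.+-suc X ⌊ e /2⌋) ⟨
      sgn (suc X ℕ.+ suc ⌊ e /2⌋)          ≡⟨ cong (λ y → sgn (y ℕ.+ suc ⌊ e /2⌋)) (⌊m+[2+n]/2⌋≡1+⌊m+n/2⌋ (suc i) e) ⟨
      S                                    ∎

  t-above-degree : ∀ {j n} → j < n → t (suc j) n ≈ 0#
  t-above-degree {n = suc n} j<1+n = t-vanishes j<1+n

  numCoeff : ℕ → ℕ → Carrier
  numCoeff k i = sgn ((i ℕ.+ 1) / 2) * fromℕ (((k ∸ i) / 2 ℕ.+ i) C i)

  innerCoeff : ℕ → ℕ → Carrier
  innerCoeff j i = sgn ((j ∸ i) / 2) * fromℕ (((j ∸ i) / 2 ℕ.+ i) C i)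

  numCoeff≈t : ∀ m {i} → i ≤ m ℕ.+ m → numCoeff (m ℕ.+ m) i ≈ t (suc (m ℕ.+ m)) i
  numCoeff≈t m {i} i≤k = ≡.subst (λ k → numCoeff k i ≈ t (suc k) i) i+e≡k (begin
    numCoeff (i ℕ.+ e) i                                     ≡⟨ halves ⟩
    sgn ⌈ i /2⌉ * fromℕ ((⌊ e /2⌋ ℕ.+ i) C i)                ≈⟨ *-congʳ sign ⟩
    closedCoeff i e                                          ≈⟨ t≈closedCoeff i e ⟨
    t (suc (i ℕ.+ e)) i                                      ∎)
    where
    e = m ℕ.+ m ∸ i
    i+e≡k : i ℕ.+ e ≡ m ℕ.+ m
    i+e≡k = ℕₚ.m+[n∸m]≡n i≤k
    halves : numCoeff (i ℕ.+ e) i ≡ sgn ⌈ i /2⌉ * fromℕ ((⌊ e /2⌋ ℕ.+ i) C i)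
    halves rewrite ℕₚ.m+n∸m≡n i e | ℕₚ.+-comm i 1 | n/2≡⌊n/2⌋ (suc i) | n/2≡⌊n/2⌋ e = ≡.refl
    sign : sgn ⌈ i /2⌉ ≈ sgn (⌊ i ℕ.+ e /2⌋ ℕ.+ ⌊ e /2⌋)
    sign = begin
      sgn ⌈ i /2⌉                                        ≈⟨ *-identityʳ _ ⟨
      sgn ⌈ i /2⌉ * 1#                                   ≈⟨ *-congˡ (sgn-even ⌊ e /2⌋) ⟨
      sgn ⌈ i /2⌉ * sgn (⌊ e /2⌋ ℕ.+ ⌊ e /2⌋)            ≈⟨ sgn-+ ⌈ i /2⌉ _ ⟨
      sgn (⌈ i /2⌉ ℕ.+ (⌊ e /2⌋ ℕ.+ ⌊ e /2⌋))            ≡⟨ cong sgn (ℕₚ.+-assoc ⌈ i /2⌉ ⌊ e /2⌋ ⌊ e /2⌋) ⟨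
      sgn (⌈ i /2⌉ ℕ.+ ⌊ e /2⌋ ℕ.+ ⌊ e /2⌋)              ≡⟨ cong (λ h → sgn (h ℕ.+ ⌊ e /2⌋)) half-i+e ⟩
      sgn (⌊ i ℕ.+ e /2⌋ ℕ.+ ⌊ e /2⌋)                    ∎
      where
      half-i+e : ⌈ i /2⌉ ℕ.+ ⌊ e /2⌋ ≡ ⌊ i ℕ.+ e /2⌋
      half-i+e = ≡.trans (⌈m/2⌉+⌊n/2⌋≡c i e m i+e≡k) (≡.trans (ℕₚ.n≡⌊n+n/2⌋ m) (cong ⌊_/2⌋ (≡.sym i+e≡k)))

  innerCoeff≈t : ∀ {i j} → i ≤ j → sgn (j / 2) * innerCoeff j i ≈ t (suc j) i
  innerCoeff≈t {i} {j} i≤j = ≡.subst (λ j → sgn (j / 2) * innerCoeff j i ≈ t (suc j) i) (ℕₚ.m+[n∸m]≡n i≤j) (begin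
    sgn ((i ℕ.+ e) / 2) * innerCoeff (i ℕ.+ e) i                        ≡⟨ halves ⟩
    sgn ⌊ i ℕ.+ e /2⌋ * (sgn ⌊ e /2⌋ * B)                               ≈⟨ *-assoc _ _ B ⟨
    sgn ⌊ i ℕ.+ e /2⌋ * sgn ⌊ e /2⌋ * B                                 ≈⟨ *-congʳ (sgn-+ ⌊ i ℕ.+ e /2⌋ ⌊ e /2⌋) ⟨
    closedCoeff i e                                                     ≈⟨ t≈closedCoeff i e ⟨
    t (suc (i ℕ.+ e)) i                                                 ∎)
    where
    e = j ∸ i
    B = fromℕ ((⌊ e /2⌋ ℕ.+ i) C i)
    halves : sgn ((i ℕ.+ e) / 2) * innerCoeff (i ℕ.+ e) i ≡ sgn ⌊ i ℕ.+ e /2⌋ * (sgn ⌊ e /2⌋ * B)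
    halves rewrite ℕₚ.m+n∸m≡n i e | n/2≡⌊n/2⌋ (i ℕ.+ e) | n/2≡⌊n/2⌋ e = ≡.refl

  numerator-coeffs : ∀ m n → sumFrom 0 (suc (m ℕ.+ m)) (λ i → numCoeff (m ℕ.+ m) i * δ i n) ≈ t (suc (m ℕ.+ m)) n
  numerator-coeffs m n with n ℕ.≤? m ℕ.+ m
  ... | yes n≤k = trans (sumFrom-δ 0 (suc (m ℕ.+ m)) _ z≤n (s≤s n≤k)) (numCoeff≈t m n≤k)
  ... | no  n≰k = trans (sumFrom-δ-outside 0 (suc (m ℕ.+ m)) _ outside) (sym (t-above-degree (ℕₚ.≰⇒> n≰k)))
    where
    outside : ∀ i → 0 ≤ i → i < suc (m ℕ.+ m) → i ≢ n
    outside i _ i<1+k i≡n = n≰k (≡.subst (_≤ m ℕ.+ m) i≡n (ℕₚ.≤-pred i<1+k))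

  inner-coeffs : ∀ j n → δ 0 n + sgn (j / 2) * sumFrom 1 j (λ i → innerCoeff j i * δ i n) ≈ t (suc j) n
  inner-coeffs j zero = begin
    1# + sgn (j / 2) * sumFrom 1 j (λ i → innerCoeff j i * δ i 0)  ≈⟨ +-congˡ (*-congˡ (sumFrom-δ-outside 1 j _ (λ { _ (s≤s _) _ () }))) ⟩
    1# + sgn (j / 2) * 0#                                          ≈⟨ +-congˡ (zeroʳ _) ⟩
    1# + 0#                                                        ≈⟨ +-identityʳ 1# ⟩
    1#                                                             ≈⟨ t-constant (suc j) ⟨
    t (suc j) 0                                                    ∎
  inner-coeffs j (suc n) with suc n ℕ.≤? j
  ... | yes 1+n≤j = trans (+-identityˡ _) (trans (*-congˡ (sumFrom-δ 1 j _ (s≤s z≤n) (s≤s 1+n≤j))) (innerCoeff≈t 1+n≤j))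
  ... | no  1+n≰j = trans (+-identityˡ _)
    (trans (*-congˡ (sumFrom-δ-outside 1 j _ outside)) (trans (zeroʳ _) (sym (t-above-degree (ℕₚ.≰⇒> 1+n≰j)))))
    where
    outside : ∀ i → 1 ≤ i → i < 1 ℕ.+ j → i ≢ suc n
    outside i _ i<1+j i≡1+n = 1+n≰j (≡.subst (_≤ j) i≡1+n (ℕₚ.≤-pred i<1+j))

module SeriesInB {c ℓ} (R : CommutativeRing c ℓ) (q : CommutativeRing.Carrier R) where
  open CommutativeRing R
  open Arithmetic
  open Series R
  open FiniteSums R
  open PowerSeries R
  open TPolynomials R
  open Powers R
  open import Relation.Binary.Reasoning.Setoid setoid

  r : Carrier
  r = q - 1#

  b : PS
  b = bS q

  b-⊛-head : ∀ f → (b ⊛ f) 0 ≈ 0#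
  b-⊛-head f = trans (⊛-assoc X (const r) f 0) (X-⊛-head (const r ⊛ f))

  b-⊛-tail : ∀ f n → (b ⊛ f) (suc n) ≈ r * f n
  b-⊛-tail f n = trans (⊛-assoc X (const r) f (suc n)) (trans (X-⊛-tail (const r ⊛ f) n) (const-⊛ r f n))

  -- The polynomial Σ p_n bⁿ in b = (q - 1) x, as a power series in x.
  ⟦_⟧ : (ℕ → Carrier) → PS
  ⟦ p ⟧ n = p n * pow r n

  b-⊛-⟦⟧ : ∀ p → b ⊛ ⟦ p ⟧ ≋ ⟦ shift p ⟧
  b-⊛-⟦⟧ p zero    = trans (b-⊛-head ⟦ p ⟧) (sym (zeroˡ 1#))
  b-⊛-⟦⟧ p (suc n) = begin
    (b ⊛ ⟦ p ⟧) (suc n)    ≈⟨ b-⊛-tail ⟦ p ⟧ n ⟩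
    r * (p n * pow r n)    ≈⟨ *-assoc r (p n) _ ⟨
    r * p n * pow r n      ≈⟨ *-congʳ (*-comm r (p n)) ⟩
    p n * r * pow r n      ≈⟨ *-assoc (p n) r _ ⟩
    p n * pow r (suc n)    ∎

  powS-b : ∀ i → powS b i ≋ ⟦ δ i ⟧
  powS-b zero    zero    = sym (*-identityˡ 1#)
  powS-b zero    (suc n) = sym (zeroˡ _)
  powS-b (suc i) n       = trans (⊛-cong {b} (λ _ → refl) (powS-b i) n) (trans (b-⊛-⟦⟧ (δ i) n) (*-congʳ (shift-δ n)))
    where
    shift-δ : ∀ n → shift (δ i) n ≈ δ (suc i) n
    shift-δ zero    = refl
    shift-δ (suc n) = refl

  monomial-sum : ∀ a l (γ : ℕ → Carrier) n →
    sumFrom a l (λ i → (const (γ i) ⊛ powS b i) n) ≈ sumFrom a l (λ i → γ i * δ i n) * pow r n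
  monomial-sum a l γ n = begin
    sumFrom a l (λ i → (const (γ i) ⊛ powS b i) n)    ≈⟨ sumFrom-cong a l (λ i → trans (const-⊛ (γ i) (powS b i) n) (*-congˡ (powS-b i n))) ⟩
    sumFrom a l (λ i → γ i * (δ i n * pow r n))       ≈⟨ sumFrom-cong a l (λ i → *-assoc (γ i) _ _) ⟨
    sumFrom a l (λ i → γ i * δ i n * pow r n)         ≈⟨ *-distribʳ-sumFrom (pow r n) a l _ ⟨
    sumFrom a l (λ i → γ i * δ i n) * pow r n         ∎

  T : ℕ → PS
  T n = ⟦ t n ⟧

  Step : ℕ → ℕ → ℕ → Set ℓ
  Step i j l = T i ≋ T j ⊕ (b ⊛ T l)

  T-even-step : ∀ a → Step (suc a ℕ.+ suc a) (a ℕ.+ a) (suc (a ℕ.+ a))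
  T-even-step a n = begin
    T (suc a ℕ.+ suc a) n                           ≡⟨ cong (λ i → T (suc i) n) (ℕₚ.+-suc a a) ⟩
    (t (a ℕ.+ a) n + sgn (a ℕ.+ a) * y) * pow r n   ≈⟨ *-congʳ (+-congˡ (trans (*-congʳ (sgn-even a)) (*-identityˡ y))) ⟩
    (t (a ℕ.+ a) n + y) * pow r n                   ≈⟨ distribʳ (pow r n) _ y ⟩
    T (a ℕ.+ a) n + y * pow r n                     ≈⟨ +-congˡ (b-⊛-⟦⟧ (t (suc (a ℕ.+ a))) n) ⟨
    T (a ℕ.+ a) n + (b ⊛ T (suc (a ℕ.+ a))) n       ∎
    where
    y = shift (t (suc (a ℕ.+ a))) n

  T-odd-step : ∀ a → Step (suc (a ℕ.+ a)) (suc (suc a ℕ.+ suc a)) (suc a ℕ.+ suc a)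
  T-odd-step a n = begin
    x * pow r n                                       ≈⟨ *-congʳ coefficients ⟩
    (t (suc (suc (suc (a ℕ.+ a)))) n + y) * pow r n   ≈⟨ distribʳ (pow r n) _ y ⟩
    T (suc (suc (suc (a ℕ.+ a)))) n + y * pow r n     ≈⟨ +-congˡ (b-⊛-⟦⟧ (t (suc (suc (a ℕ.+ a)))) n) ⟨
    T (suc (suc (suc (a ℕ.+ a)))) n + (b ⊛ T (suc (suc (a ℕ.+ a)))) n
                                                      ≡⟨ cong (λ i → T (suc (suc i)) n + (b ⊛ T (suc i)) n) (ℕₚ.+-suc a a) ⟨
    T (suc (suc a ℕ.+ suc a)) n + (b ⊛ T (suc a ℕ.+ suc a)) n ∎
    where
    x = t (suc (a ℕ.+ a)) n
    y = shift (t (suc (suc (a ℕ.+ a)))) n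
    coefficients : x ≈ x + sgn (suc (a ℕ.+ a)) * y + y
    coefficients = begin
      x                                   ≈⟨ +-identityʳ x ⟨
      x + 0#                              ≈⟨ +-congˡ (-‿inverseˡ y) ⟨
      x + (- y + y)                       ≈⟨ +-assoc x (- y) y ⟨
      x + - y + y                         ≈⟨ +-congʳ (+-congˡ (-1*x≈-x y)) ⟨
      x + - 1# * y + y                    ≈⟨ +-congʳ (+-congˡ (*-congʳ (sgn-odd a))) ⟨
      x + sgn (suc (a ℕ.+ a)) * y + y     ∎
      where open import Algebra.Properties.Ring ring using (-1*x≈-x)

  Num≋T : ∀ m → Num (m ℕ.+ m) q ≋ T (suc (m ℕ.+ m))
  Num≋T m n = trans (monomial-sum 0 (suc (m ℕ.+ m)) (numCoeff (m ℕ.+ m)) n) (*-congʳ (numerator-coeffs m n))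

  innerTerm≋T : ∀ j → const 1# ⊕ (const (sgn (j / 2)) ⊛ ΣS[ 1 ⋯ j ] (λ i → const (innerCoeff j i) ⊛ powS b i)) ≋ T (suc j)
  innerTerm≋T j n = begin
    const 1# n + (const s ⊛ ΣS[ 1 ⋯ j ] M) n           ≈⟨ +-cong (const1≈δ0 n) (const-⊛ s (ΣS[ 1 ⋯ j ] M) n) ⟩
    δ 0 n * pow r n + s * sumFrom 1 j (λ i → M i n)     ≈⟨ +-congˡ (*-congˡ (monomial-sum 1 j (innerCoeff j) n)) ⟩
    δ 0 n * pow r n + s * (Σγδ * pow r n)               ≈⟨ +-congˡ (*-assoc s Σγδ _) ⟨
    δ 0 n * pow r n + s * Σγδ * pow r n                 ≈⟨ distribʳ (pow r n) _ _ ⟨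
    (δ 0 n + s * Σγδ) * pow r n                         ≈⟨ *-congʳ (inner-coeffs j n) ⟩
    T (suc j) n                                         ∎
    where
    s = sgn (j / 2)
    M : ℕ → PS
    M i = const (innerCoeff j i) ⊛ powS b i
    Σγδ = sumFrom 1 j (λ i → innerCoeff j i * δ i n)
    const1≈δ0 : const 1# ≋ ⟦ δ 0 ⟧
    const1≈δ0 zero    = sym (*-identityˡ 1#)
    const1≈δ0 (suc n) = sym (zeroˡ _)

  Inner≋ΣT : ∀ k → Inner (suc k) q ≋ (λ n → sumFrom 0 (suc k) (λ j → T (suc j) n))
  Inner≋ΣT k n = sumFrom-cong 0 (suc k) (λ j → innerTerm≋T j n)

  tIndex-step : ∀ m u w → suc (suc (u ℕ.+ w)) ≡ m ℕ.+ m → Step (tIndex m (suc u)) (tIndex m u) (tIndex m w)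
  tIndex-step (suc zero)    zero    zero    _  = T-even-step 0
  tIndex-step (suc (suc m)) zero    w       eq =
    ≡.subst (Step (suc (m ℕ.+ m)) (suc (suc m ℕ.+ suc m)))
            (≡.trans (≡.sym (tIndex-high (suc (suc m)) m)) (cong (tIndex (suc (suc m))) w≡))
            (T-odd-step m)
    where
    w≡ : suc (suc m) ℕ.+ m ≡ w
    w≡ = ≡.sym (≡.trans (2+x≡[1+m]+[1+m]⇒x≡m+m {w} {suc m} eq) (cong suc (ℕₚ.+-suc m m)))
  tIndex-step (suc (suc m)) (suc u) zero    eq =
    ≡.subst₂ (λ i j → Step i j (suc (suc m ℕ.+ suc m)))
             (≡.trans (≡.sym (tIndex-high (suc m) (suc m))) (cong (tIndex (suc m)) (≡.sym 1+u≡)))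
             (≡.trans (≡.sym (tIndex-high (suc m) m)) (cong (tIndex (suc m)) u≡))
             (T-even-step (suc m))
    where
    1+u≡ : suc u ≡ suc m ℕ.+ suc m
    1+u≡ = ≡.trans (≡.sym (ℕₚ.+-identityʳ (suc u))) (2+x≡[1+m]+[1+m]⇒x≡m+m {suc u ℕ.+ 0} {suc m} eq)
    u≡ : suc m ℕ.+ m ≡ u
    u≡ = ≡.sym (≡.trans (ℕₚ.suc-injective 1+u≡) (ℕₚ.+-suc m m))
  tIndex-step (suc m)       (suc u) (suc w) eq =
    tIndex-step m u w (≡.trans (cong suc (≡.sym (ℕₚ.+-suc u w))) (2+x≡[1+m]+[1+m]⇒x≡m+m {suc u ℕ.+ suc w} {m} eq))
  tIndex-step zero          _       _       ()
  tIndex-step (suc zero)    zero    (suc _) ()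
  tIndex-step (suc zero)    (suc _) zero    ()

  sumFrom-tIndex : ∀ m n → sumFrom 0 (m ℕ.+ m) (λ v → T (tIndex m v) n) ≈ sumFrom 0 (m ℕ.+ m) (λ j → T (suc j) n)
  sumFrom-tIndex m n = begin
    sumFrom 0 (m ℕ.+ m) U                                                 ≈⟨ sumFrom-++ 0 m m U ⟩
    sumFrom 0 m U + sumFrom m m U                                         ≈⟨ +-cong low high ⟩
    sumFrom 0 m (λ i → T (suc (i ℕ.+ i)) n) + sumFrom 0 m (λ i → T (suc (suc (i ℕ.+ i))) n)
                                                                          ≈⟨ sumFrom-+ 0 m _ _ ⟨
    sumFrom 0 m (λ i → T (suc (i ℕ.+ i)) n + T (suc (suc (i ℕ.+ i))) n)   ≈⟨ sumFrom-pairs m (λ j → T (suc j) n) ⟨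
    sumFrom 0 (m ℕ.+ m) (λ j → T (suc j) n)                               ∎
    where
    U : ℕ → Carrier
    U v = T (tIndex m v) n
    low : sumFrom 0 m U ≈ sumFrom 0 m (λ i → T (suc (i ℕ.+ i)) n)
    low = begin
      sumFrom 0 m U                            ≈⟨ sumFrom-reverse m U ⟨
      sumFrom 0 m (λ i → U (m ∸ suc i))        ≈⟨ sumFrom-cong-range 0 m (λ i _ i<m → reflexive (cong (λ j → T j n) (mirrored i<m))) ⟩
      sumFrom 0 m (λ i → T (suc (i ℕ.+ i)) n)  ∎
      where
      mirrored : ∀ {i} → i < m → tIndex m (m ∸ suc i) ≡ suc (i ℕ.+ i)
      mirrored {i} i<m = ≡.trans (cong (λ M → tIndex M (m ∸ suc i)) (≡.sym (ℕₚ.m∸n+n≡m i<m))) (tIndex-low (m ∸ suc i) i)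
    high : sumFrom m m U ≈ sumFrom 0 m (λ i → T (suc (suc (i ℕ.+ i))) n)
    high = begin
      sumFrom m m U                                   ≡⟨ sumFrom-offset m m U ⟩
      sumFrom 0 m (λ i → T (tIndex m (m ℕ.+ i)) n)    ≈⟨ sumFrom-cong 0 m (λ i → reflexive (cong (λ j → T j n) (upper i))) ⟩
      sumFrom 0 m (λ i → T (suc (suc (i ℕ.+ i))) n)   ∎
      where
      upper : ∀ i → tIndex m (m ℕ.+ i) ≡ suc (suc (i ℕ.+ i))
      upper i = ≡.trans (tIndex-high m i) (cong suc (ℕₚ.+-suc i i))

module Words {c ℓ} (R : CommutativeRing c ℓ) (q : CommutativeRing.Carrier R) (k : ℕ) where
  open CommutativeRing R
  open Series R
  open FiniteSums R
  open PowerSeries R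
  open Powers R using (pow-+)
  open SeriesInB R q using (r; b; b-⊛-head; b-⊛-tail)
  open LinearSystems R using (indicator)
  open import Relation.Binary.Reasoning.Setoid setoid

  -- Letters are numbered from 0 here: v stands for the letter v + 1 of [k].
  connector : ℕ → ℕ → Bool
  connector v u = k <ᵇ suc v ℕ.+ suc u

  weight : ℕ → ℕ → Carrier
  weight v u = pow q (if connector v u then 1 else 0)

  weight≈1+r*indicator : ∀ v u → weight v u ≈ 1# + r * indicator (connector v u)
  weight≈1+r*indicator v u with connector v u
  ... | true  = begin
    q * 1#                ≈⟨ *-identityʳ q ⟩
    q                     ≈⟨ xyx⁻¹≈y 1# q ⟨
    1# + q - 1#           ≈⟨ +-assoc 1# q (- 1#) ⟩
    1# + r                ≈⟨ +-congˡ (*-identityʳ r) ⟨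
    1# + r * 1#           ∎
    where open import Algebra.Properties.AbelianGroup +-abelianGroup using (xyx⁻¹≈y)
  ... | false = sym (trans (+-congˡ (zeroʳ r)) (+-identityʳ 1#))

  weightFrom : ℕ → ℕ → Carrier
  weightFrom zero    v = 1#
  weightFrom (suc n) v = sumFrom 0 k (λ u → weight v u * weightFrom n u)

  -- GC sums with a local function of Series; abstracting over words k n exposes it as h.
  GC≡sumList : ∀ n → GC k q n ≡ sumList (λ π → pow q (gkcon k π)) (words k n)
  GC≡sumList n = ≡.trans GC≡h (Listₚ.foldr-universal h _ 0# ≡.refl (λ _ _ → ≡.refl) (words k n))
    where
    h : List (Vec (Fin k) n) → Carrier
    h = _
    GC≡h : GC k q n ≡ h (words k n)
    GC≡h with words k n
    ... | πs = ≡.refl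

  sumList-words-from : ∀ n (a : Fin k) →
    sumList (λ w → pow q (gkcon k (a Vec.∷ w))) (words k n) ≈ weightFrom n (toℕ a)
  sumList-words-from zero    a = +-identityʳ 1#
  sumList-words-from (suc n) a = begin
    sumList (λ w → pow q (gkcon k (a Vec.∷ w))) (concatMap (λ a′ → map (a′ Vec.∷_) (words k n)) (allFin k))
      ≈⟨ sumList-concatMap _ _ (allFin k) ⟩
    sumList (λ a′ → sumList (λ w → pow q (gkcon k (a Vec.∷ w))) (map (a′ Vec.∷_) (words k n))) (allFin k)
      ≈⟨ sumList-cong (allFin k) second-letter ⟩
    sumList (λ a′ → weight (toℕ a) (toℕ a′) * weightFrom n (toℕ a′)) (allFin k)
      ≈⟨ sumList-allFin k (λ u → weight (toℕ a) u * weightFrom n u) ⟩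
    weightFrom (suc n) (toℕ a)
      ∎
    where
    second-letter : ∀ a′ → sumList (λ w → pow q (gkcon k (a Vec.∷ w))) (map (a′ Vec.∷_) (words k n))
                             ≈ weight (toℕ a) (toℕ a′) * weightFrom n (toℕ a′)
    second-letter a′ = begin
      sumList (λ w → pow q (gkcon k (a Vec.∷ w))) (map (a′ Vec.∷_) (words k n))
        ≡⟨ sumList-map _ (a′ Vec.∷_) (words k n) ⟩
      sumList (λ w → pow q (gkcon k (a Vec.∷ a′ Vec.∷ w))) (words k n)
        ≈⟨ sumList-cong (words k n) (λ w → pow-+ q connections (gkcon k (a′ Vec.∷ w))) ⟩
      sumList (λ w → weight (toℕ a) (toℕ a′) * pow q (gkcon k (a′ Vec.∷ w))) (words k n)
        ≈⟨ *-distribˡ-sumList _ _ (words k n) ⟨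
      weight (toℕ a) (toℕ a′) * sumList (λ w → pow q (gkcon k (a′ Vec.∷ w))) (words k n)
        ≈⟨ *-congˡ (sumList-words-from n a′) ⟩
      weight (toℕ a) (toℕ a′) * weightFrom n (toℕ a′)
        ∎
      where
      connections = if connector (toℕ a) (toℕ a′) then 1 else 0

  GC-zero : GC k q 0 ≈ 1#
  GC-zero = trans (reflexive (GC≡sumList 0)) (+-identityʳ 1#)

  GC-suc : ∀ n → GC k q (suc n) ≈ sumFrom 0 k (λ v → weightFrom n v)
  GC-suc n = begin
    GC k q (suc n)
      ≡⟨ GC≡sumList (suc n) ⟩
    sumList (λ π → pow q (gkcon k π)) (concatMap (λ a → map (a Vec.∷_) (words k n)) (allFin k))
      ≈⟨ sumList-concatMap _ _ (allFin k) ⟩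
    sumList (λ a → sumList (λ π → pow q (gkcon k π)) (map (a Vec.∷_) (words k n))) (allFin k)
      ≈⟨ sumList-cong (allFin k) (λ a → trans (reflexive (sumList-map _ (a Vec.∷_) (words k n))) (sumList-words-from n a)) ⟩
    sumList (λ a → weightFrom n (toℕ a)) (allFin k)
      ≈⟨ sumList-allFin k (λ v → weightFrom n v) ⟩
    sumFrom 0 k (λ v → weightFrom n v)
      ∎

  G : ℕ → PS
  G v n = weightFrom n v

  GC≋1+X⊛ΣG : GC k q ≋ const 1# ⊕ (X ⊛ sumFromS 0 k G)
  GC≋1+X⊛ΣG zero    = trans GC-zero (sym (trans (+-congˡ (X-⊛-head (sumFromS 0 k G))) (+-identityʳ 1#)))
  GC≋1+X⊛ΣG (suc n) = begin
    GC k q (suc n)                       ≈⟨ GC-suc n ⟩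
    sumFrom 0 k (λ v → weightFrom n v)   ≡⟨ sumFromS-coeff 0 k G n ⟨
    sumFromS 0 k G n                     ≈⟨ X-⊛-tail (sumFromS 0 k G) n ⟨
    (X ⊛ sumFromS 0 k G) (suc n)         ≈⟨ +-identityˡ _ ⟨
    0# + (X ⊛ sumFromS 0 k G) (suc n)    ∎

  indicatorS : Bool → PS
  indicatorS = LinearSystems.indicator powerSeriesRing

  indicatorS-⊛ : ∀ β f n → (indicatorS β ⊛ f) n ≈ indicator β * f n
  indicatorS-⊛ true  f n = const-⊛ 1# f n
  indicatorS-⊛ false f n = begin
    sumFrom 0 (suc n) (λ i → 0# * f (n ∸ i))   ≈⟨ sumFrom-cong 0 (suc n) (λ i → zeroˡ (f (n ∸ i))) ⟩
    sumFrom 0 (suc n) (λ _ → 0#)               ≈⟨ sumFrom-0# 0 (suc n) ⟩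
    0#                                         ≈⟨ zeroˡ (f n) ⟨
    0# * f n                                   ∎

  G-solves : ∀ v → G v ≋ GC k q ⊕ (b ⊛ sumFromS 0 k (λ u → indicatorS (connector v u) ⊛ G u))
  G-solves v zero = begin
    1#                   ≈⟨ +-identityʳ 1# ⟨
    1# + 0#              ≈⟨ +-cong GC-zero (b-⊛-head S) ⟨
    GC k q 0 + (b ⊛ S) 0 ∎
    where
    S = sumFromS 0 k (λ u → indicatorS (connector v u) ⊛ G u)
  G-solves v (suc n) = begin
    sumFrom 0 k (λ u → weight v u * w u)                            ≈⟨ sumFrom-cong 0 k split ⟩
    sumFrom 0 k (λ u → w u + r * (ι u * w u))                       ≈⟨ sumFrom-+ 0 k _ _ ⟩
    sumFrom 0 k w + sumFrom 0 k (λ u → r * (ι u * w u))             ≈⟨ +-cong (GC-suc n) (*-distribˡ-sumFrom r 0 k _) ⟨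
    GC k q (suc n) + r * sumFrom 0 k (λ u → ι u * w u)              ≈⟨ +-congˡ (*-congˡ S-coeff) ⟨
    GC k q (suc n) + r * S n                                        ≈⟨ +-congˡ (b-⊛-tail S n) ⟨
    GC k q (suc n) + (b ⊛ S) (suc n)                                ∎
    where
    S = sumFromS 0 k (λ u → indicatorS (connector v u) ⊛ G u)
    w : ℕ → Carrier
    w u = weightFrom n u
    ι : ℕ → Carrier
    ι u = indicator (connector v u)
    split : ∀ u → weight v u * w u ≈ w u + r * (ι u * w u)
    split u = begin
      weight v u * w u              ≈⟨ *-congʳ (weight≈1+r*indicator v u) ⟩
      (1# + r * ι u) * w u          ≈⟨ distribʳ (w u) 1# _ ⟩
      1# * w u + r * ι u * w u      ≈⟨ +-cong (*-identityˡ (w u)) (*-assoc r (ι u) (w u)) ⟩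
      w u + r * (ι u * w u)         ∎
    S-coeff : S n ≈ sumFrom 0 k (λ u → ι u * w u)
    S-coeff = trans (reflexive (sumFromS-coeff 0 k _ n)) (sumFrom-cong 0 k (λ u → indicatorS-⊛ (connector v u) (G u) n))

module EvenAlphabet {c ℓ} (R : CommutativeRing c ℓ) (q : CommutativeRing.Carrier R) (a : ℕ) where
  open CommutativeRing R using (trans; sym; reflexive)
  open Series R
  open PowerSeries R
  open SeriesInB R q
  open Arithmetic using (tIndex; tIndex-high)
  private
    𝕊 = powerSeriesRing
    module 𝕊 = CommutativeRing 𝕊
    module 𝕊L = LinearSystems 𝕊

  k : ℕ
  k = suc a ℕ.+ suc a

  open Words R q k

  N : PS
  N = T (suc k)

  U : ℕ → PS
  U v = T (tIndex (suc a) v)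

  U-solves : ∀ u → u < k → U u ≋ N ⊕ (b ⊛ sumFromS 0 k (λ v → indicatorS (connector v u) ⊛ U v))
  U-solves u u<k = 𝕊.trans (𝕊L.suffix-sums k U N b first (tIndex-step (suc a)) u w w+1+u≡k)
                           (𝕊.+-congˡ (𝕊.*-congˡ (𝕊.sym (𝕊L.sumFrom-indicator k u w U w+1+u≡k))))
    where
    w = k ∸ suc u
    w+1+u≡k : w ℕ.+ suc u ≡ k
    w+1+u≡k = ℕₚ.m∸n+n≡m u<k
    first : ∀ w → suc w ≡ k → U 0 ≋ N ⊕ (b ⊛ U w)
    first w 1+w≡k = ≡.subst (Step (suc (a ℕ.+ a)) (suc k))
                            (≡.trans (≡.sym (tIndex-high (suc a) a)) (cong (tIndex (suc a)) w≡))
                            (T-odd-step a)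
      where
      w≡ : suc a ℕ.+ a ≡ w
      w≡ = ≡.sym (≡.trans (ℕₚ.suc-injective 1+w≡k) (ℕₚ.+-suc a a))

  ΣU≋Inner : sumFromS 0 k U ≋ Inner k q
  ΣU≋Inner n = trans (reflexive (sumFromS-coeff 0 k U n)) (trans (sumFrom-tIndex (suc a) n) (sym (Inner≋ΣT (a ℕ.+ suc a) n)))

  GC⊛Den≋Num : GC k q ⊛ Den k q ≋ Num k q
  GC⊛Den≋Num = begin
    GC k q ⊛ (Num k q ⊖ (X ⊛ Inner k q))    ≈⟨ 𝕊.*-congˡ (𝕊.+-cong (Num≋T (suc a)) (𝕊.-‿cong (𝕊.*-congˡ (𝕊.sym ΣU≋Inner)))) ⟩
    GC k q ⊛ (N ⊖ (X ⊛ ΣU))                 ≈⟨ x[y-z]≈xy-xz (GC k q) N (X ⊛ ΣU) ⟩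
    (GC k q ⊛ N) ⊖ (GC k q ⊛ (X ⊛ ΣU))      ≈⟨ 𝕊.+-cong GC⊛N (𝕊.-‿cong GC⊛X⊛ΣU) ⟩
    (N ⊕ Y) ⊖ Y                             ≈⟨ 𝕊.+-assoc N Y (𝕊.- Y) ⟩
    N ⊕ (Y ⊖ Y)                             ≈⟨ 𝕊.+-congˡ (𝕊.-‿inverseʳ Y) ⟩
    N ⊕ 𝕊.0#                                ≈⟨ 𝕊.+-identityʳ N ⟩
    N                                       ≈⟨ Num≋T (suc a) ⟨
    Num k q                                 ∎
    where
    open import Relation.Binary.Reasoning.Setoid 𝕊.setoid
    open import Algebra.Properties.Ring 𝕊.ring using (x[y-z]≈xy-xz)
    open import Algebra.Solver.Ring.NaturalCoefficients.Default 𝕊.commutativeSemiring using (solve; _:+_; _:*_; _:=_)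
    ΣG = sumFromS 0 k G
    ΣU = sumFromS 0 k U
    Y = X ⊛ (ΣU ⊛ GC k q)
    GC⊛X⊛ΣU : GC k q ⊛ (X ⊛ ΣU) ≋ Y
    GC⊛X⊛ΣU = solve 3 (λ g x u → g :* (x :* u) := x :* (u :* g)) 𝕊.refl (GC k q) X ΣU
    dual : N ⊛ ΣG ≋ ΣU ⊛ GC k q
    dual = 𝕊L.dual-systems k (λ v u → indicatorS (connector v u)) b (GC k q) N G U (λ v _ → G-solves v) U-solves
    GC⊛N : GC k q ⊛ N ≋ N ⊕ Y
    GC⊛N = begin
      GC k q ⊛ N                     ≈⟨ 𝕊.*-congʳ GC≋1+X⊛ΣG ⟩
      (𝕊.1# ⊕ (X ⊛ ΣG)) ⊛ N          ≈⟨ solve 4 (λ o x g n → (o :+ x :* g) :* n := o :* n :+ x :* (n :* g))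
                                               𝕊.refl 𝕊.1# X ΣG N ⟩
      (𝕊.1# ⊛ N) ⊕ (X ⊛ (N ⊛ ΣG))    ≈⟨ 𝕊.+-cong (𝕊.*-identityˡ N) (𝕊.*-congˡ dual) ⟩
      N ⊕ Y                          ∎

open import Data.Nat using (_+_)

theorem3 : {c ℓ : Level} (k : ℕ) → (∃[ m ] k ≡ m + m) → 2 ≤ k →
    (R : CommutativeRing c ℓ) → (q : CommutativeRing.Carrier R) →
    (n : ℕ) →
    CommutativeRing._≈_ R
      (Series._⊛_ R (Series.GC R k q) (Series.Den R k q) n)
      (Series.Num R k q n)
theorem3 _ (zero  , ≡.refl) ()
theorem3 _ (suc a , ≡.refl) _ R q = EvenAlphabet.GC⊛Den≋Num R q a
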